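{- Let $(g_n(k))$ and $(h_n(k))$ ($n\ge1$, $1\le k\le 2n-1$) be as follows. Both satisfy $$f_n(k+2)-2f_n(k+1)+f_n(k)+4\,f_{n-1}(k)=0\qquad (n\ge 2,\ 1\le k\le 2n-3);$$ $(g_n(k))$ is the unique solution with $f_1(1)=1$ and, for $n\ge2$, $f_n(1)=0$, $f_n(2)=2\sum_k f_{n-1}(k)$; $(h_n(k))$ is the unique solution with $f_1(1)=1$ and, for $n\ge2$, $f_n(1)=\sum_k f_{n-1}(k)$, $f_n(2)=3\sum_kf_{n-1}(k)$. For such a family $f$ put $$Z(x,y):=1+\sum_{n\ge1}\sum_{1\le k\le 2n+1} f_{n+1}(k)\,\frac{x^{2n+1-k}}{(2n+1-k)!}\,\frac{y^{k-1}}{(k-1)!},$$ and let $Z^{\tan}$ (resp. $Z^{\sec}$) be this series for $f=g$ (resp. $f=h$). Then, as formal power series, $$Z^{\tan}(x,y)=\sec(x+y)\cos(x-y),\qquad Z^{\sec}(x,y)=\sec^2(x+y)\cos(x-y).$$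
   Context: $\sec u=1/\cos u$. The recursion determines each solution uniquely from the stated initial values. -}

module Defs where

open import Data.Nat as ℕ using (ℕ; zero; suc; _∸_; _≤_; _!)
open import Data.Nat.Properties using (_!≢0; _!*_!≢0)
open import Data.Nat.Combinatorics using (_C_)
open import Data.Integer as ℤ using (ℤ; +_; -[1+_])
open import Data.Rational as ℚ using (ℚ; 0ℚ; 1ℚ; _/_)
open import Data.List as List using (List; []; _∷_; upTo; zipWith; map)
open import Data.Maybe using (Maybe; just; nothing)
import Data.Maybe as Maybe
open import Relation.Binary.PropositionalEquality using (_≡_)

-- Families f_n(k) are modelled as functions ℕ → ℕ → ℤ (f n k = f_n(k));
-- only the values with n ≥ 1, 1 ≤ k ≤ 2n-1 are constrained/used.

rowSum : (ℕ → ℕ → ℤ) → ℕ → ℤ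
rowSum f n = List.foldr ℤ._+_ (+ 0) (map (λ i → f n (suc i)) (upTo (2 ℕ.* n ∸ 1)))

-- f_n(k+2) - 2 f_n(k+1) + f_n(k) + 4 f_{n-1}(k) = 0  for n ≥ 2, 1 ≤ k ≤ 2n-3
-- (written with n = m+2, so n-1 = m+1 and 2n-3 = 2m+1)
Recurrence : (ℕ → ℕ → ℤ) → Set
Recurrence f = ∀ m k → 1 ≤ k → k ≤ 2 ℕ.* m ℕ.+ 1 →
  ((f (suc (suc m)) (k ℕ.+ 2) ℤ.- (+ 2) ℤ.* f (suc (suc m)) (k ℕ.+ 1))
     ℤ.+ f (suc (suc m)) k) ℤ.+ (+ 4) ℤ.* f (suc m) k ≡ + 0

IsG : (ℕ → ℕ → ℤ) → Set
IsG f = Recurrence f × (f 1 1 ≡ + 1)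
  × (∀ m → f (suc (suc m)) 1 ≡ + 0)
  × (∀ m → f (suc (suc m)) 2 ≡ (+ 2) ℤ.* rowSum f (suc m))
  where open import Data.Product using (_×_)

IsH : (ℕ → ℕ → ℤ) → Set
IsH f = Recurrence f × (f 1 1 ≡ + 1)
  × (∀ m → f (suc (suc m)) 1 ≡ rowSum f (suc m))
  × (∀ m → f (suc (suc m)) 2 ≡ (+ 3) ℤ.* rowSum f (suc m))
  where open import Data.Product using (_×_)

-- Formal power series over ℚ.
-- One variable: ℕ → ℚ (coefficient of u^n).
-- Two variables: ℕ → ℕ → ℚ (coefficient of x^a y^b).

PS1 : Set
PS1 = ℕ → ℚ

PS2 : Set
PS2 = ℕ → ℕ → ℚ

half : ℕ → Maybe ℕ
half zero = just zero
half (suc zero) = nothing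
half (suc (suc n)) = Maybe.map suc (half n)

sgn : ℕ → ℤ
sgn zero = + 1
sgn (suc m) = ℤ.- sgn m

cosS : PS1
cosS n with half n
... | just m = (sgn m / ((2 ℕ.* m) !)) {{(2 ℕ.* m) !≢0}}
... | nothing = 0ℚ

sumℚ : List ℚ → ℚ
sumℚ = List.foldr ℚ._+_ 0ℚ

-- sec u = 1 / cos u as formal power series: the unique s with cos·s = 1,
-- computed by s_0 = 1, s_{n} = - Σ_{j=1}^{n} cos_j s_{n-j}  (cos_0 = 1).
-- secUpTo n = [s_n, s_{n-1}, ..., s_0]
secUpTo : ℕ → List ℚ
secUpTo zero = 1ℚ ∷ []
secUpTo (suc n) =
  ℚ.- sumℚ (zipWith (λ j s → cosS (suc j) ℚ.* s) (upTo (suc n)) (secUpTo n))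
  ∷ secUpTo n

secS : PS1
secS n with secUpTo n
... | s ∷ _ = s
... | [] = 0ℚ

ofℕ : ℕ → ℚ
ofℕ n = (+ n) / 1

-- F(x + y): coefficient of x^a y^b is F_{a+b} * C(a+b, a)
atSum : PS1 → PS2
atSum F a b = F (a ℕ.+ b) ℚ.* ofℕ ((a ℕ.+ b) C a)

-- F(x - y): coefficient of x^a y^b is F_{a+b} * C(a+b, a) * (-1)^b
atDiff : PS1 → PS2
atDiff F a b = (F (a ℕ.+ b) ℚ.* ofℕ ((a ℕ.+ b) C a)) ℚ.* (sgn b / 1)

_⊛_ : PS2 → PS2 → PS2
(F ⊛ G) a b =
  sumℚ (map (λ i → sumℚ (map (λ j → F i j ℚ.* G (a ∸ i) (b ∸ j)) (upTo (suc b))))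
            (upTo (suc a)))

-- Coefficient of x^a y^b: with k = b+1 and 2n = a+b, this is
-- f_{n+1}(b+1)/(a! b!) when a+b = 2n ≥ 2; 1 when a = b = 0; 0 when a+b odd.
Z : (ℕ → ℕ → ℤ) → PS2
Z f a b with half (a ℕ.+ b)
... | nothing = 0ℚ
... | just zero = 1ℚ
... | just (suc n) = (f (suc (suc n)) (suc b) / (a ! ℕ.* b !)) {{a !* b !≢0}}

module Submission where

-- Let L = ∂x − ∂y.  L kills F(x+y) and sends F(x−y) to 2F′(x−y); being a
-- derivation, with cos″ = −cos it gives L²P = −4P for P = G·cos(x−y) whenever
-- L G = 0, in particular for G = sec(x+y) and G = sec²(x+y).  For the rescaled
-- coefficients Q(a,b) = a! b! [xᵃyᵇ]P this is the recurrence of the families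
-- (k = b+1, 2n = a+b+2).  Summed along an antidiagonal it telescopes, and with
-- the symmetry P(x,y) = P(y,x) it ties the antidiagonal sum to Q(N+2,0) and
-- Q(N+1,1); these boundary values come from sec·cos = 1 and match the
-- prescribed f_n(1), f_n(2).  Induction over the rows shows that each family
-- has the rescaled coefficients of P, and since P is even, Z f = P.

open import Data.Nat as ℕ using (ℕ; zero; suc; _∸_; _!)
open import Data.Nat.Properties as ℕP using (_!≢0; _!*_!≢0)
open import Data.Nat.Combinatorics using (_C_; nCk≡n!/k![n-k]!; k![n∸k]!∣n!; nCn≡1)
import Data.Nat.DivMod as ℕDivMod
import Data.Nat.Solver as ℕSolver
open import Data.Integer as ℤ using (ℤ; +_)
import Data.Integer.Properties as ℤP
open import Data.Integer.Solver using (module +-*-Solver)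
open import Data.Rational using (ℚ; 0ℚ; 1ℚ; _/_; _+_; _*_; -_; _-_; toℚᵘ; fromℚᵘ)
open import Data.Rational.Properties as ℚP
  using (toℚᵘ-injective; toℚᵘ-fromℚᵘ; toℚᵘ-homo-+; toℚᵘ-homo-*; toℚᵘ-homo‿-; fromℚᵘ-cong)
open import Data.Rational.Unnormalised as ℚᵘ using (mkℚᵘ; *≡*)
import Data.Rational.Unnormalised.Properties as ℚᵘP
import Data.Rational.Solver as ℚSolver
open import Data.List as List using ([]; _∷_; upTo; applyUpTo; map; zipWith)
open import Data.List.Properties using (map-∘)
open import Data.Maybe as Maybe using (just; nothing)
open import Data.Product using (_×_; _,_; proj₁; proj₂)
open import Data.Sum using (_⊎_; inj₁; inj₂)
open import Function using (_∘_; id)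
open import Relation.Binary.PropositionalEquality
open ≡-Reasoning
open import Defs

module ℤS = +-*-Solver
module ℕS = ℕSolver.+-*-Solver
open ℚSolver.+-*-Solver using (solve; _:+_; _:*_; _:-_; :-_; _:=_; con)

fromℚᵘ-+ : ∀ p q → fromℚᵘ (p ℚᵘ.+ q) ≡ fromℚᵘ p + fromℚᵘ q
fromℚᵘ-+ p q = toℚᵘ-injective
  (ℚᵘP.≃-trans (toℚᵘ-fromℚᵘ (p ℚᵘ.+ q))
  (ℚᵘP.≃-trans (ℚᵘP.+-cong (ℚᵘP.≃-sym (toℚᵘ-fromℚᵘ p)) (ℚᵘP.≃-sym (toℚᵘ-fromℚᵘ q)))
               (ℚᵘP.≃-sym (toℚᵘ-homo-+ (fromℚᵘ p) (fromℚᵘ q)))))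

fromℚᵘ-* : ∀ p q → fromℚᵘ (p ℚᵘ.* q) ≡ fromℚᵘ p * fromℚᵘ q
fromℚᵘ-* p q = toℚᵘ-injective
  (ℚᵘP.≃-trans (toℚᵘ-fromℚᵘ (p ℚᵘ.* q))
  (ℚᵘP.≃-trans (ℚᵘP.*-cong (ℚᵘP.≃-sym (toℚᵘ-fromℚᵘ p)) (ℚᵘP.≃-sym (toℚᵘ-fromℚᵘ q)))
               (ℚᵘP.≃-sym (toℚᵘ-homo-* (fromℚᵘ p) (fromℚᵘ q)))))

fromℚᵘ-neg : ∀ p → fromℚᵘ (ℚᵘ.- p) ≡ - fromℚᵘ p
fromℚᵘ-neg p = toℚᵘ-injective
  (ℚᵘP.≃-trans (toℚᵘ-fromℚᵘ (ℚᵘ.- p))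
  (ℚᵘP.≃-trans (ℚᵘP.-‿cong (ℚᵘP.≃-sym (toℚᵘ-fromℚᵘ p)))
               (ℚᵘP.≃-sym (toℚᵘ-homo‿- (fromℚᵘ p)))))

ι : ℤ → ℚ
ι z = z / 1

ι-+ : ∀ a b → ι (a ℤ.+ b) ≡ ι a + ι b
ι-+ a b = trans (fromℚᵘ-cong {mkℚᵘ (a ℤ.+ b) 0} {mkℚᵘ a 0 ℚᵘ.+ mkℚᵘ b 0}
                  (*≡* (ℤS.solve 2 (λ a b → (a ℤS.:+ b) ℤS.:* ℤS.con (+ 1)
                          ℤS.:= (a ℤS.:* ℤS.con (+ 1) ℤS.:+ b ℤS.:* ℤS.con (+ 1)) ℤS.:* ℤS.con (+ 1)) refl a b)))
                (fromℚᵘ-+ (mkℚᵘ a 0) (mkℚᵘ b 0))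

ι-* : ∀ a b → ι (a ℤ.* b) ≡ ι a * ι b
ι-* a b = trans (fromℚᵘ-cong {mkℚᵘ (a ℤ.* b) 0} {mkℚᵘ a 0 ℚᵘ.* mkℚᵘ b 0}
                  (*≡* (ℤS.solve 2 (λ a b → (a ℤS.:* b) ℤS.:* ℤS.con (+ 1) ℤS.:= (a ℤS.:* b) ℤS.:* ℤS.con (+ 1)) refl a b)))
                (fromℚᵘ-* (mkℚᵘ a 0) (mkℚᵘ b 0))

ι-neg : ∀ a → ι (ℤ.- a) ≡ - ι a
ι-neg a = trans (fromℚᵘ-cong {mkℚᵘ (ℤ.- a) 0} {ℚᵘ.- mkℚᵘ a 0} (*≡* refl)) (fromℚᵘ-neg (mkℚᵘ a 0))

ofℕ-+ : ∀ m n → ofℕ (m ℕ.+ n) ≡ ofℕ m + ofℕ n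
ofℕ-+ m n = trans (cong ι (ℤP.pos-+ m n)) (ι-+ (+ m) (+ n))

ofℕ-* : ∀ m n → ofℕ (m ℕ.* n) ≡ ofℕ m * ofℕ n
ofℕ-* m n = trans (cong ι (ℤP.pos-* m n)) (ι-* (+ m) (+ n))

two three four : ℚ
two = ofℕ 2
three = ofℕ 3
four = ofℕ 4

/-*-cancel : ∀ i d .{{_ : ℕ.NonZero d}} → (i / d) * ofℕ d ≡ ι i
/-*-cancel i (suc k) = trans (sym (fromℚᵘ-* (mkℚᵘ i k) (mkℚᵘ (+ suc k) 0)))
  (fromℚᵘ-cong {mkℚᵘ i k ℚᵘ.* mkℚᵘ (+ suc k) 0} {mkℚᵘ i 0}
    (*≡* (ℤS.solve 2 (λ i s → (i ℤS.:* s) ℤS.:* ℤS.con (+ 1) ℤS.:= i ℤS.:* (s ℤS.:* ℤS.con (+ 1))) refl i (+ suc k))))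

*-cancelˡ-suc : ∀ n x y → ofℕ (suc n) * x ≡ ofℕ (suc n) * y → x ≡ y
*-cancelˡ-suc n x y eq = begin
  x                        ≡⟨ sym (ℚP.*-identityˡ x) ⟩
  1ℚ * x                   ≡⟨ cong (_* x) (sym recip-inverse) ⟩
  (recip * ofℕ (suc n)) * x ≡⟨ ℚP.*-assoc recip _ x ⟩
  recip * (ofℕ (suc n) * x) ≡⟨ cong (recip *_) eq ⟩
  recip * (ofℕ (suc n) * y) ≡⟨ sym (ℚP.*-assoc recip _ y) ⟩
  (recip * ofℕ (suc n)) * y ≡⟨ cong (_* y) recip-inverse ⟩
  1ℚ * y                   ≡⟨ ℚP.*-identityˡ y ⟩
  y                        ∎
  where
  recip : ℚ
  recip = (+ 1) / suc n
  recip-inverse : recip * ofℕ (suc n) ≡ 1ℚ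
  recip-inverse = /-*-cancel (+ 1) (suc n)

*-cancel-nonZero : ∀ k .{{_ : ℕ.NonZero k}} x y → ofℕ k * x ≡ ofℕ k * y → x ≡ y
*-cancel-nonZero (suc k) = *-cancelˡ-suc k

*≡ι⇒≡/ : ∀ x i d .{{_ : ℕ.NonZero d}} → x * ofℕ d ≡ ι i → x ≡ i / d
*≡ι⇒≡/ x i (suc k) eq = *-cancelˡ-suc k x (i / suc k)
  (trans (ℚP.*-comm (ofℕ (suc k)) x)
  (trans eq (trans (sym (/-*-cancel i (suc k))) (ℚP.*-comm (i / suc k) (ofℕ (suc k))))))

Σ : ℕ → (ℕ → ℚ) → ℚ
Σ zero f = 0ℚ
Σ (suc n) f = Σ n f + f n

Σ-cong : ∀ n {f g} → (∀ i → i ℕ.< n → f i ≡ g i) → Σ n f ≡ Σ n g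
Σ-cong zero h = refl
Σ-cong (suc n) h = cong₂ _+_ (Σ-cong n (λ i i<n → h i (ℕP.m<n⇒m<1+n i<n))) (h n ℕP.≤-refl)

Σ-cong′ : ∀ n {f g} → (∀ i → f i ≡ g i) → Σ n f ≡ Σ n g
Σ-cong′ n h = Σ-cong n (λ i _ → h i)

Σ-front : ∀ n f → Σ (suc n) f ≡ f 0 + Σ n (f ∘ suc)
Σ-front zero f = trans (ℚP.+-identityˡ (f 0)) (sym (ℚP.+-identityʳ (f 0)))
Σ-front (suc n) f = begin
  Σ (suc n) f + f (suc n)           ≡⟨ cong (_+ f (suc n)) (Σ-front n f) ⟩
  (f 0 + Σ n (f ∘ suc)) + f (suc n) ≡⟨ ℚP.+-assoc (f 0) _ _ ⟩
  f 0 + Σ (suc n) (f ∘ suc)         ∎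

Σ-+ : ∀ n f g → Σ n (λ i → f i + g i) ≡ Σ n f + Σ n g
Σ-+ zero f g = refl
Σ-+ (suc n) f g = trans (cong (_+ (f n + g n)) (Σ-+ n f g))
  (solve 4 (λ a b c d → (a :+ b) :+ (c :+ d) := (a :+ c) :+ (b :+ d)) refl (Σ n f) (Σ n g) (f n) (g n))

Σ-*ˡ : ∀ n c f → c * Σ n f ≡ Σ n (λ i → c * f i)
Σ-*ˡ zero c f = ℚP.*-zeroʳ c
Σ-*ˡ (suc n) c f = trans (ℚP.*-distribˡ-+ c (Σ n f) (f n)) (cong (_+ c * f n) (Σ-*ˡ n c f))

Σ-0 : ∀ n → Σ n (λ _ → 0ℚ) ≡ 0ℚ
Σ-0 zero = refl
Σ-0 (suc n) = trans (ℚP.+-identityʳ _) (Σ-0 n)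

Σ-neg : ∀ n f → - Σ n f ≡ Σ n (λ i → - f i)
Σ-neg zero f = refl
Σ-neg (suc n) f = trans (ℚP.neg-distrib-+ (Σ n f) (f n)) (cong (_+ - f n) (Σ-neg n f))

Σ-swap : ∀ m n (f : ℕ → ℕ → ℚ) → Σ m (λ i → Σ n (f i)) ≡ Σ n (λ j → Σ m (λ i → f i j))
Σ-swap zero n f = sym (Σ-0 n)
Σ-swap (suc m) n f = trans (cong (_+ Σ n (f m)) (Σ-swap m n f)) (sym (Σ-+ n (λ j → Σ m (λ i → f i j)) (f m)))

Σ-reverse : ∀ n f → Σ n f ≡ Σ n (λ i → f (n ∸ suc i))
Σ-reverse zero f = refl
Σ-reverse (suc n) f = begin
  Σ n f + f n                                      ≡⟨ cong (_+ f n) (Σ-reverse n f) ⟩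
  Σ n (λ i → f (n ∸ suc i)) + f n                  ≡⟨ ℚP.+-comm _ (f n) ⟩
  f (suc n ∸ 1) + Σ n (λ i → f (suc n ∸ suc (suc i))) ≡⟨ sym (Σ-front n (λ i → f (suc n ∸ suc i))) ⟩
  Σ (suc n) (λ i → f (suc n ∸ suc i))              ∎

Σ-second-difference : ∀ N (t : ℕ → ℚ) →
  Σ (suc N) (λ i → (t i - two * t (suc i)) + t (suc (suc i))) ≡ ((t 0 - t 1) - t (suc N)) + t (suc (suc N))
Σ-second-difference zero t =
  solve 3 (λ a b c → con 0ℚ :+ ((a :- con two :* b) :+ c) := ((a :- b) :- b) :+ c) refl (t 0) (t 1) (t 2)
Σ-second-difference (suc N) t =
  trans (cong (_+ ((t (suc N) - two * t (suc (suc N))) + t (suc (suc (suc N))))) (Σ-second-difference N t))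
    (solve 5 (λ a b c d e → (((a :- b) :- c) :+ d) :+ ((c :- con two :* d) :+ e) := ((a :- b) :- d) :+ e)
       refl (t 0) (t 1) (t (suc N)) (t (suc (suc N))) (t (suc (suc (suc N)))))

Σ² : ℕ → ℕ → (ℕ → ℕ → ℚ) → ℚ
Σ² m n f = Σ m (λ i → Σ n (f i))

Σ²-cong : ∀ m n {f g} → (∀ i j → f i j ≡ g i j) → Σ² m n f ≡ Σ² m n g
Σ²-cong m n h = Σ-cong′ m (λ i → Σ-cong′ n (h i))

Σ²-+ : ∀ m n f g → Σ² m n (λ i j → f i j + g i j) ≡ Σ² m n f + Σ² m n g
Σ²-+ m n f g = trans (Σ-cong′ m (λ i → Σ-+ n (f i) (g i))) (Σ-+ m _ _)

Σ²-*ˡ : ∀ m n c f → c * Σ² m n f ≡ Σ² m n (λ i j → c * f i j)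
Σ²-*ˡ m n c f = trans (Σ-*ˡ m c _) (Σ-cong′ m (λ i → Σ-*ˡ n c (f i)))

Σ²-0 : ∀ m n → Σ² m n (λ _ _ → 0ℚ) ≡ 0ℚ
Σ²-0 m n = trans (Σ-cong′ m (λ i → Σ-0 n)) (Σ-0 m)

sum-applyUpTo : ∀ n (φ : ℕ → ℚ) → sumℚ (applyUpTo φ n) ≡ Σ n φ
sum-applyUpTo zero φ = refl
sum-applyUpTo (suc n) φ = trans (cong (_+_ (φ 0)) (sum-applyUpTo n (φ ∘ suc))) (sym (Σ-front n φ))

map-applyUpTo : ∀ {A B : Set} (f : A → B) g n → map f (applyUpTo g n) ≡ applyUpTo (f ∘ g) n
map-applyUpTo f g zero = refl
map-applyUpTo f g (suc n) = cong (f (g 0) ∷_) (map-applyUpTo f (g ∘ suc) n)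

zipWith-applyUpTo : ∀ {A B C : Set} (f : A → B → C) g h n →
  zipWith f (applyUpTo g n) (applyUpTo h n) ≡ applyUpTo (λ i → f (g i) (h i)) n
zipWith-applyUpTo f g h zero = refl
zipWith-applyUpTo f g h (suc n) = cong (f (g 0) (h 0) ∷_) (zipWith-applyUpTo f (g ∘ suc) (h ∘ suc) n)

sum-map-upTo : ∀ n (f : ℕ → ℚ) → sumℚ (map f (upTo n)) ≡ Σ n f
sum-map-upTo n f = trans (cong sumℚ (map-applyUpTo f id n)) (sum-applyUpTo n f)

_≗₁_ : PS1 → PS1 → Set
f ≗₁ g = ∀ n → f n ≡ g n

_≈₂_ : PS2 → PS2 → Set
F ≈₂ G = ∀ a b → F a b ≡ G a b

∂ : PS1 → PS1
∂ p n = ofℕ (suc n) * p (suc n)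

_✶_ : PS1 → PS1 → PS1
(p ✶ q) n = Σ (suc n) (λ i → p i * q (n ∸ i))

∂x ∂y swap : PS2 → PS2
∂x F a b = ofℕ (suc a) * F (suc a) b
∂y F a b = ofℕ (suc b) * F a (suc b)
swap F a b = F b a

_·_ : ℚ → PS2 → PS2
(c · F) a b = c * F a b

𝟘 : PS2
𝟘 a b = 0ℚ

⊛-Σ : ∀ F G a b → (F ⊛ G) a b ≡ Σ² (suc a) (suc b) (λ i j → F i j * G (a ∸ i) (b ∸ j))
⊛-Σ F G a b = trans (sum-map-upTo (suc a) _) (Σ-cong′ (suc a) (λ i → sum-map-upTo (suc b) _))

-- Leibniz rule at the level of a single convolution sum: the weight a+1 of
-- the term (i, a+1−i) splits as i + (a+1−i).
convolution-Leibniz : ∀ a (φ : ℕ → ℕ → ℚ) →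
  ofℕ (suc a) * Σ (suc (suc a)) (λ i → φ i (suc a ∸ i))
  ≡ Σ (suc a) (λ i → ofℕ (suc i) * φ (suc i) (a ∸ i)) + Σ (suc a) (λ i → ofℕ (suc (a ∸ i)) * φ i (suc (a ∸ i)))
convolution-Leibniz a φ = begin
  ofℕ (suc a) * Σ (suc (suc a)) (λ i → φ i (suc a ∸ i))
    ≡⟨ Σ-*ˡ (suc (suc a)) (ofℕ (suc a)) (λ i → φ i (suc a ∸ i)) ⟩
  Σ (suc (suc a)) (λ i → ofℕ (suc a) * φ i (suc a ∸ i))
    ≡⟨ Σ-cong (suc (suc a)) split ⟩
  Σ (suc (suc a)) (λ i → left i + right i)
    ≡⟨ Σ-+ (suc (suc a)) left right ⟩
  Σ (suc (suc a)) left + Σ (suc (suc a)) right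
    ≡⟨ cong (_+ Σ (suc (suc a)) right) (Σ-front (suc a) left) ⟩
  (left 0 + Σ (suc a) (left ∘ suc)) + (Σ (suc a) right + right (suc a))
    ≡⟨ cong₂ (λ u v → (u + Σ (suc a) (left ∘ suc)) + (Σ (suc a) right + v)) (ℚP.*-zeroˡ (φ 0 (suc a ∸ 0))) last-right ⟩
  (0ℚ + Σ (suc a) (left ∘ suc)) + (Σ (suc a) right + 0ℚ)
    ≡⟨ cong₂ _+_ (ℚP.+-identityˡ (Σ (suc a) (left ∘ suc))) (trans (ℚP.+-identityʳ (Σ (suc a) right)) (Σ-cong (suc a) inner-right)) ⟩
  Σ (suc a) (λ i → ofℕ (suc i) * φ (suc i) (a ∸ i)) + Σ (suc a) (λ i → ofℕ (suc (a ∸ i)) * φ i (suc (a ∸ i))) ∎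
  where
  left right : ℕ → ℚ
  left i = ofℕ i * φ i (suc a ∸ i)
  right i = ofℕ (suc a ∸ i) * φ i (suc a ∸ i)
  split : ∀ i → i ℕ.< suc (suc a) → ofℕ (suc a) * φ i (suc a ∸ i) ≡ left i + right i
  split i (ℕ.s≤s i≤sa) =
    trans (cong (λ n → ofℕ n * φ i (suc a ∸ i)) (sym (ℕP.m+[n∸m]≡n i≤sa)))
      (trans (cong (_* φ i (suc a ∸ i)) (ofℕ-+ i (suc a ∸ i))) (ℚP.*-distribʳ-+ (φ i (suc a ∸ i)) (ofℕ i) _))
  last-right : right (suc a) ≡ 0ℚ
  last-right = trans (cong (λ n → ofℕ n * φ (suc a) (suc a ∸ suc a)) (ℕP.n∸n≡0 (suc a))) (ℚP.*-zeroˡ (φ (suc a) (a ∸ a)))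
  inner-right : ∀ i → i ℕ.< suc a → right i ≡ ofℕ (suc (a ∸ i)) * φ i (suc (a ∸ i))
  inner-right i (ℕ.s≤s i≤a) rewrite ℕP.+-∸-assoc 1 i≤a = refl

*-middle : ∀ c x y → c * (x * y) ≡ x * (c * y)
*-middle = solve 3 (λ c x y → c :* (x :* y) := x :* (c :* y)) refl

∂-✶ : ∀ p q n → ∂ (p ✶ q) n ≡ (∂ p ✶ q) n + (p ✶ ∂ q) n
∂-✶ p q n = trans (convolution-Leibniz n (λ i k → p i * q k))
  (cong₂ _+_ (Σ-cong′ (suc n) (λ i → sym (ℚP.*-assoc (ofℕ (suc i)) (p (suc i)) (q (n ∸ i)))))
             (Σ-cong′ (suc n) (λ i → *-middle (ofℕ (suc (n ∸ i))) (p i) (q (suc (n ∸ i))))))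

∂x-⊛ : ∀ F G a b → ∂x (F ⊛ G) a b ≡ (∂x F ⊛ G) a b + (F ⊛ ∂x G) a b
∂x-⊛ F G a b = begin
  ofℕ (suc a) * (F ⊛ G) (suc a) b
    ≡⟨ cong (ofℕ (suc a) *_) (⊛-Σ F G (suc a) b) ⟩
  ofℕ (suc a) * Σ (suc (suc a)) (λ i → φ i (suc a ∸ i))
    ≡⟨ convolution-Leibniz a φ ⟩
  Σ (suc a) (λ i → ofℕ (suc i) * φ (suc i) (a ∸ i)) + Σ (suc a) (λ i → ofℕ (suc (a ∸ i)) * φ i (suc (a ∸ i)))
    ≡⟨ cong₂ _+_ (Σ-cong′ (suc a) (λ i → pull (ofℕ (suc i)) (F (suc i)) (G (a ∸ i)) (λ x y → sym (ℚP.*-assoc (ofℕ (suc i)) x y))))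
                 (Σ-cong′ (suc a) (λ i → pull (ofℕ (suc (a ∸ i))) (F i) (G (suc (a ∸ i))) (*-middle (ofℕ (suc (a ∸ i)))))) ⟩
  Σ² (suc a) (suc b) (λ i j → ∂x F i j * G (a ∸ i) (b ∸ j)) + Σ² (suc a) (suc b) (λ i j → F i j * ∂x G (a ∸ i) (b ∸ j))
    ≡⟨ sym (cong₂ _+_ (⊛-Σ (∂x F) G a b) (⊛-Σ F (∂x G) a b)) ⟩
  (∂x F ⊛ G) a b + (F ⊛ ∂x G) a b ∎
  where
  φ : ℕ → ℕ → ℚ
  φ i k = Σ (suc b) (λ j → F i j * G k (b ∸ j))
  pull : ∀ c (u v : ℕ → ℚ) {r : ℚ → ℚ → ℚ} → (∀ x y → c * (x * y) ≡ r x y) →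
         c * Σ (suc b) (λ j → u j * v (b ∸ j)) ≡ Σ (suc b) (λ j → r (u j) (v (b ∸ j)))
  pull c u v move = trans (Σ-*ˡ (suc b) c _) (Σ-cong′ (suc b) (λ j → move (u j) (v (b ∸ j))))

-- Transposition commutes with products; this transfers ∂x-facts to ∂y.
swap-⊛ : ∀ F G → swap (F ⊛ G) ≈₂ (swap F ⊛ swap G)
swap-⊛ F G a b = trans (⊛-Σ F G b a) (trans (Σ-swap (suc b) (suc a) _) (sym (⊛-Σ (swap F) (swap G) a b)))

∂y-⊛ : ∀ F G a b → ∂y (F ⊛ G) a b ≡ (∂y F ⊛ G) a b + (F ⊛ ∂y G) a b
∂y-⊛ F G a b = begin
  ofℕ (suc b) * (F ⊛ G) a (suc b)
    ≡⟨ cong (ofℕ (suc b) *_) (swap-⊛ F G (suc b) a) ⟩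
  ∂x (swap F ⊛ swap G) b a
    ≡⟨ ∂x-⊛ (swap F) (swap G) b a ⟩
  (swap (∂y F) ⊛ swap G) b a + (swap F ⊛ swap (∂y G)) b a
    ≡⟨ sym (cong₂ _+_ (swap-⊛ (∂y F) G b a) (swap-⊛ F (∂y G) b a)) ⟩
  (∂y F ⊛ G) a b + (F ⊛ ∂y G) a b ∎

⊛-cong : ∀ {F F′ G G′} → F ≈₂ F′ → G ≈₂ G′ → (F ⊛ G) ≈₂ (F′ ⊛ G′)
⊛-cong {F} {F′} {G} {G′} e₁ e₂ a b = trans (⊛-Σ F G a b) (trans
  (Σ²-cong (suc a) (suc b) (λ i j → cong₂ _*_ (e₁ i j) (e₂ (a ∸ i) (b ∸ j)))) (sym (⊛-Σ F′ G′ a b)))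

⊛-congˡ : ∀ {F F′} G → F ≈₂ F′ → (F ⊛ G) ≈₂ (F′ ⊛ G)
⊛-congˡ {F} {F′} G e = ⊛-cong {F} {F′} {G} {G} e (λ _ _ → refl)

⊛-congʳ : ∀ F {G G′} → G ≈₂ G′ → (F ⊛ G) ≈₂ (F ⊛ G′)
⊛-congʳ F {G} {G′} e = ⊛-cong {F} {F} {G} {G′} (λ _ _ → refl) e

Σ²-− : ∀ m n f g → Σ² m n (λ i j → f i j - g i j) ≡ Σ² m n f - Σ² m n g
Σ²-− m n f g = begin
  Σ² m n (λ i j → f i j - g i j)        ≡⟨ Σ²-+ m n f (λ i j → - g i j) ⟩
  Σ² m n f + Σ² m n (λ i j → - g i j)   ≡⟨ cong (_+_ (Σ² m n f)) (sym (trans (Σ-neg m _) (Σ-cong′ m (λ i → Σ-neg n (g i))))) ⟩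
  Σ² m n f - Σ² m n g                   ∎

⊛-−ˡ : ∀ F F′ G a b → Σ² (suc a) (suc b) (λ i j → (F i j - F′ i j) * G (a ∸ i) (b ∸ j)) ≡ (F ⊛ G) a b - (F′ ⊛ G) a b
⊛-−ˡ F F′ G a b = trans
  (Σ²-cong (suc a) (suc b) (λ i j → solve 3 (λ x y z → (x :- y) :* z := x :* z :- y :* z) refl (F i j) (F′ i j) (G (a ∸ i) (b ∸ j))))
  (trans (Σ²-− (suc a) (suc b) _ _) (sym (cong₂ _-_ (⊛-Σ F G a b) (⊛-Σ F′ G a b))))

⊛-−ʳ : ∀ F G G′ a b → Σ² (suc a) (suc b) (λ i j → F i j * (G (a ∸ i) (b ∸ j) - G′ (a ∸ i) (b ∸ j))) ≡ (F ⊛ G) a b - (F ⊛ G′) a b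
⊛-−ʳ F G G′ a b = trans
  (Σ²-cong (suc a) (suc b) (λ i j → solve 3 (λ x y z → x :* (y :- z) := x :* y :- x :* z) refl (F i j) (G (a ∸ i) (b ∸ j)) (G′ (a ∸ i) (b ∸ j))))
  (trans (Σ²-− (suc a) (suc b) _ _) (sym (cong₂ _-_ (⊛-Σ F G a b) (⊛-Σ F G′ a b))))

⊛-·ʳ : ∀ c F G → (F ⊛ (c · G)) ≈₂ (c · (F ⊛ G))
⊛-·ʳ c F G a b = trans (⊛-Σ F (c · G) a b) (trans
  (Σ²-cong (suc a) (suc b) (λ i j → sym (*-middle c (F i j) (G (a ∸ i) (b ∸ j)))))
  (trans (sym (Σ²-*ˡ (suc a) (suc b) c _)) (cong (c *_) (sym (⊛-Σ F G a b)))))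

⊛-𝟘ˡ : ∀ G → (𝟘 ⊛ G) ≈₂ 𝟘
⊛-𝟘ˡ G a b = trans (⊛-Σ 𝟘 G a b) (trans (Σ²-cong (suc a) (suc b) (λ i j → ℚP.*-zeroˡ (G (a ∸ i) (b ∸ j)))) (Σ²-0 (suc a) (suc b)))

⊛-𝟘ʳ : ∀ F → (F ⊛ 𝟘) ≈₂ 𝟘
⊛-𝟘ʳ F a b = trans (⊛-Σ F 𝟘 a b) (trans (Σ²-cong (suc a) (suc b) (λ i j → ℚP.*-zeroʳ (F i j))) (Σ²-0 (suc a) (suc b)))

L : PS2 → PS2
L F a b = ∂x F a b - ∂y F a b

L-cong : ∀ {F G} → F ≈₂ G → L F ≈₂ L G
L-cong e a b = cong₂ (λ u v → ofℕ (suc a) * u - ofℕ (suc b) * v) (e (suc a) b) (e a (suc b))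

L-· : ∀ c F → L (c · F) ≈₂ (c · L F)
L-· c F a b = solve 5 (λ x y c u v → x :* (c :* u) :- y :* (c :* v) := c :* (x :* u :- y :* v)) refl
  (ofℕ (suc a)) (ofℕ (suc b)) c (F (suc a) b) (F a (suc b))

L-⊛ : ∀ F G a b → L (F ⊛ G) a b ≡ (L F ⊛ G) a b + (F ⊛ L G) a b
L-⊛ F G a b = begin
  ∂x (F ⊛ G) a b - ∂y (F ⊛ G) a b
    ≡⟨ cong₂ _-_ (∂x-⊛ F G a b) (∂y-⊛ F G a b) ⟩
  ((∂x F ⊛ G) a b + (F ⊛ ∂x G) a b) - ((∂y F ⊛ G) a b + (F ⊛ ∂y G) a b)
    ≡⟨ solve 4 (λ p q r s → (p :+ q) :- (r :+ s) := (p :- r) :+ (q :- s)) refl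
         ((∂x F ⊛ G) a b) ((F ⊛ ∂x G) a b) ((∂y F ⊛ G) a b) ((F ⊛ ∂y G) a b) ⟩
  ((∂x F ⊛ G) a b - (∂y F ⊛ G) a b) + ((F ⊛ ∂x G) a b - (F ⊛ ∂y G) a b)
    ≡⟨ sym (cong₂ _+_ (trans (⊛-Σ (L F) G a b) (⊛-−ˡ (∂x F) (∂y F) G a b))
                      (trans (⊛-Σ F (L G) a b) (⊛-−ʳ F (∂x G) (∂y G) a b))) ⟩
  (L F ⊛ G) a b + (F ⊛ L G) a b ∎

L-⊛-constant : ∀ G → L G ≈₂ 𝟘 → ∀ H → L (G ⊛ H) ≈₂ (G ⊛ L H)
L-⊛-constant G LG≈𝟘 H a b = begin
  L (G ⊛ H) a b                ≡⟨ L-⊛ G H a b ⟩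
  (L G ⊛ H) a b + (G ⊛ L H) a b ≡⟨ cong (_+ (G ⊛ L H) a b) (trans (⊛-congˡ H LG≈𝟘 a b) (⊛-𝟘ˡ H a b)) ⟩
  0ℚ + (G ⊛ L H) a b           ≡⟨ ℚP.+-identityˡ _ ⟩
  (G ⊛ L H) a b                ∎

C-factorials : ∀ a b → ((a ℕ.+ b) C a) ℕ.* (a ! ℕ.* b !) ≡ (a ℕ.+ b) !
C-factorials a b = begin
  ((a ℕ.+ b) C a) ℕ.* (a ! ℕ.* b !)
    ≡⟨ cong (λ x → ((a ℕ.+ b) C a) ℕ.* (a ! ℕ.* x !)) (sym (ℕP.m+n∸m≡n a b)) ⟩
  ((a ℕ.+ b) C a) ℕ.* (a ! ℕ.* (a ℕ.+ b ∸ a) !)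
    ≡⟨ cong (ℕ._* (a ! ℕ.* (a ℕ.+ b ∸ a) !)) (nCk≡n!/k![n-k]! a≤a+b) ⟩
  ((a ℕ.+ b) ! ℕ./ (a ! ℕ.* (a ℕ.+ b ∸ a) !)) ℕ.* (a ! ℕ.* (a ℕ.+ b ∸ a) !)
    ≡⟨ ℕDivMod.m/n*n≡m (k![n∸k]!∣n! a≤a+b) ⟩
  (a ℕ.+ b) ! ∎
  where
  a≤a+b = ℕP.m≤m+n a b
  instance _ = a !* (a ℕ.+ b ∸ a) !≢0

C-sym : ∀ a b → (a ℕ.+ b) C a ≡ (b ℕ.+ a) C b
C-sym a b = ℕP.*-cancelʳ-≡ _ _ (a ! ℕ.* b !) {{a !* b !≢0}} (begin
  ((a ℕ.+ b) C a) ℕ.* (a ! ℕ.* b !)  ≡⟨ C-factorials a b ⟩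
  (a ℕ.+ b) !                        ≡⟨ cong _! (ℕP.+-comm a b) ⟩
  (b ℕ.+ a) !                        ≡⟨ sym (C-factorials b a) ⟩
  ((b ℕ.+ a) C b) ℕ.* (b ! ℕ.* a !)  ≡⟨ cong (((b ℕ.+ a) C b) ℕ.*_) (ℕP.*-comm (b !) (a !)) ⟩
  ((b ℕ.+ a) C b) ℕ.* (a ! ℕ.* b !)  ∎)

C-absorption : ∀ a b → suc a ℕ.* (suc (a ℕ.+ b) C suc a) ≡ suc (a ℕ.+ b) ℕ.* ((a ℕ.+ b) C a)
C-absorption a b = ℕP.*-cancelʳ-≡ _ _ (a ! ℕ.* b !) {{a !* b !≢0}} (begin
  suc a ℕ.* c₁ ℕ.* (a ! ℕ.* b !)
    ≡⟨ ℕS.solve 4 (λ x c y z → x ℕS.:* c ℕS.:* (y ℕS.:* z) ℕS.:= c ℕS.:* ((x ℕS.:* y) ℕS.:* z)) refl (suc a) c₁ (a !) (b !) ⟩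
  c₁ ℕ.* (suc a ! ℕ.* b !)                     ≡⟨ C-factorials (suc a) b ⟩
  suc (a ℕ.+ b) !                              ≡⟨ cong (suc (a ℕ.+ b) ℕ.*_) (sym (C-factorials a b)) ⟩
  suc (a ℕ.+ b) ℕ.* (c₀ ℕ.* (a ! ℕ.* b !))     ≡⟨ sym (ℕP.*-assoc (suc (a ℕ.+ b)) c₀ _) ⟩
  suc (a ℕ.+ b) ℕ.* c₀ ℕ.* (a ! ℕ.* b !)       ∎)
  where
  c₁ = suc (a ℕ.+ b) C suc a
  c₀ = (a ℕ.+ b) C a

∂x-atSum : ∀ F → ∂x (atSum F) ≈₂ atSum (∂ F)
∂x-atSum F a b = begin
  ofℕ (suc a) * (F (suc (a ℕ.+ b)) * ofℕ c₁)
    ≡⟨ *-middle (ofℕ (suc a)) (F (suc (a ℕ.+ b))) (ofℕ c₁) ⟩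
  F (suc (a ℕ.+ b)) * (ofℕ (suc a) * ofℕ c₁)
    ≡⟨ cong (F (suc (a ℕ.+ b)) *_) absorption ⟩
  F (suc (a ℕ.+ b)) * (ofℕ (suc (a ℕ.+ b)) * ofℕ c₀)
    ≡⟨ solve 3 (λ x f c → f :* (x :* c) := (x :* f) :* c) refl (ofℕ (suc (a ℕ.+ b))) (F (suc (a ℕ.+ b))) (ofℕ c₀) ⟩
  (ofℕ (suc (a ℕ.+ b)) * F (suc (a ℕ.+ b))) * ofℕ c₀ ∎
  where
  c₁ = suc (a ℕ.+ b) C suc a
  c₀ = (a ℕ.+ b) C a
  absorption : ofℕ (suc a) * ofℕ c₁ ≡ ofℕ (suc (a ℕ.+ b)) * ofℕ c₀
  absorption = trans (sym (ofℕ-* (suc a) c₁)) (trans (cong ofℕ (C-absorption a b)) (ofℕ-* (suc (a ℕ.+ b)) c₀))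

swap-atSum : ∀ F → swap (atSum F) ≈₂ atSum F
swap-atSum F a b = cong₂ _*_ (cong F (ℕP.+-comm b a)) (cong ofℕ (sym (C-sym a b)))

∂y-atSum : ∀ F → ∂y (atSum F) ≈₂ atSum (∂ F)
∂y-atSum F a b = trans (cong (ofℕ (suc b) *_) (swap-atSum F (suc b) a))
  (trans (∂x-atSum F b a) (swap-atSum (∂ F) a b))

∂x-atDiff : ∀ F → ∂x (atDiff F) ≈₂ atDiff (∂ F)
∂x-atDiff F a b = trans (sym (ℚP.*-assoc (ofℕ (suc a)) (atSum F (suc a) b) (ι (sgn b))))
  (cong (_* ι (sgn b)) (∂x-atSum F a b))

∂y-atDiff : ∀ F a b → ∂y (atDiff F) a b ≡ - atDiff (∂ F) a b
∂y-atDiff F a b = begin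
  ofℕ (suc b) * (atSum F a (suc b) * ι (ℤ.- sgn b))
    ≡⟨ cong (λ u → ofℕ (suc b) * (atSum F a (suc b) * u)) (ι-neg (sgn b)) ⟩
  ofℕ (suc b) * (atSum F a (suc b) * - ι (sgn b))
    ≡⟨ solve 3 (λ x f s → x :* (f :* (:- s)) := :- ((x :* f) :* s)) refl (ofℕ (suc b)) (atSum F a (suc b)) (ι (sgn b)) ⟩
  - ((ofℕ (suc b) * atSum F a (suc b)) * ι (sgn b))
    ≡⟨ cong (λ u → - (u * ι (sgn b))) (∂y-atSum F a b) ⟩
  - atDiff (∂ F) a b ∎

L-atSum : ∀ F → L (atSum F) ≈₂ 𝟘
L-atSum F a b = trans (cong₂ _-_ (∂x-atSum F a b) (∂y-atSum F a b)) (ℚP.+-inverseʳ (atSum (∂ F) a b))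

L-atDiff : ∀ F → L (atDiff F) ≈₂ (two · atDiff (∂ F))
L-atDiff F a b = trans (cong₂ _-_ (∂x-atDiff F a b) (∂y-atDiff F a b))
  (solve 1 (λ x → x :- (:- x) := con two :* x) refl (atDiff (∂ F) a b))

atDiff-cong : ∀ {F G} → F ≗₁ G → atDiff F ≈₂ atDiff G
atDiff-cong e a b = cong (λ u → (u * ofℕ ((a ℕ.+ b) C a)) * ι (sgn b)) (e (a ℕ.+ b))

double-suc : ∀ m → 2 ℕ.* suc m ≡ suc (suc (2 ℕ.* m))
double-suc m = cong suc (ℕP.+-suc m (m ℕ.+ 0))

half-even : ∀ m → half (2 ℕ.* m) ≡ just m
half-even zero = refl
half-even (suc m) = trans (cong half (double-suc m)) (cong (Maybe.map suc) (half-even m))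

half-odd : ∀ m → half (suc (2 ℕ.* m)) ≡ nothing
half-odd zero = refl
half-odd (suc m) = trans (cong (half ∘ suc) (double-suc m)) (cong (Maybe.map suc) (half-odd m))

data Parity : ℕ → Set where
  even : ∀ m → Parity (2 ℕ.* m)
  odd  : ∀ m → Parity (suc (2 ℕ.* m))

parity : ∀ n → Parity n
parity zero = even 0
parity (suc n) with parity n
... | even m = odd m
... | odd m = subst Parity (double-suc m) (even (suc m))

half-just : ∀ n {m} → half n ≡ just m → n ≡ 2 ℕ.* m
half-just n eq with parity n
... | odd k with () ← trans (sym eq) (half-odd k)
... | even k with refl ← trans (sym (half-even k)) eq = refl

half-+ : ∀ x y → half (x ℕ.+ y) ≡ nothing → half x ≡ nothing ⊎ half y ≡ nothing
half-+ x y eq with parity x | parity y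
... | odd m | _ = inj₁ (half-odd m)
... | even m | odd k = inj₂ (half-odd k)
... | even m | even k with () ← trans (sym (trans (cong half (sym (ℕP.*-distribˡ-+ 2 m k))) (half-even (m ℕ.+ k)))) eq

Even₁ : PS1 → Set
Even₁ F = ∀ n → half n ≡ nothing → F n ≡ 0ℚ

cos-even : Even₁ cosS
cos-even n eq with half n
cos-even n refl | nothing = refl

cos-coefficient : ∀ n m → half n ≡ just m → cosS n * ofℕ ((2 ℕ.* m) !) ≡ ι (sgn m)
cos-coefficient n m eq with half n
cos-coefficient n m refl | just .m = /-*-cancel (sgn m) ((2 ℕ.* m) !) {{(2 ℕ.* m) !≢0}}

∂∂cos : ∀ n → ∂ (∂ cosS) n ≡ - cosS n
∂∂cos n with parity n
... | odd m = begin
  a₂ * (a₃ * cosS (suc (suc (suc (2 ℕ.* m)))))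
    ≡⟨ cong (λ u → a₂ * (a₃ * u)) (cos-even (suc (suc (suc (2 ℕ.* m)))) (trans (cong (half ∘ suc) (sym (double-suc m))) (half-odd (suc m)))) ⟩
  a₂ * (a₃ * 0ℚ)
    ≡⟨ solve 2 (λ x y → x :* (y :* con 0ℚ) := :- con 0ℚ) refl a₂ a₃ ⟩
  - 0ℚ
    ≡⟨ cong -_ (sym (cos-even (suc (2 ℕ.* m)) (half-odd m))) ⟩
  - cosS (suc (2 ℕ.* m)) ∎
  where
  a₂ = ofℕ (suc (suc (2 ℕ.* m)))
  a₃ = ofℕ (suc (suc (suc (2 ℕ.* m))))
... | even m = *-cancel-nonZero ((2 ℕ.* m) !) {{(2 ℕ.* m) !≢0}} _ _ (begin
  f₀ * (a₁ * (a₂ * c₂))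
    ≡⟨ solve 4 (λ f x y c → f :* (x :* (y :* c)) := c :* (y :* (x :* f))) refl f₀ a₁ a₂ c₂ ⟩
  c₂ * (a₂ * (a₁ * f₀))
    ≡⟨ cong (λ u → c₂ * (a₂ * u)) (sym (ofℕ-* (suc (2 ℕ.* m)) ((2 ℕ.* m) !))) ⟩
  c₂ * (a₂ * ofℕ (suc (2 ℕ.* m) !))
    ≡⟨ cong (c₂ *_) (sym (ofℕ-* (suc (suc (2 ℕ.* m))) (suc (2 ℕ.* m) !))) ⟩
  c₂ * ofℕ (suc (suc (2 ℕ.* m)) !)
    ≡⟨ cong (λ k → c₂ * ofℕ (k !)) (sym (double-suc m)) ⟩
  c₂ * ofℕ ((2 ℕ.* suc m) !)
    ≡⟨ cos-coefficient (suc (suc (2 ℕ.* m))) (suc m) (trans (cong half (sym (double-suc m))) (half-even (suc m))) ⟩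
  ι (ℤ.- sgn m)
    ≡⟨ ι-neg (sgn m) ⟩
  - ι (sgn m)
    ≡⟨ cong -_ (sym (cos-coefficient (2 ℕ.* m) m (half-even m))) ⟩
  - (cosS (2 ℕ.* m) * f₀)
    ≡⟨ solve 2 (λ c f → :- (c :* f) := f :* (:- c)) refl (cosS (2 ℕ.* m)) f₀ ⟩
  f₀ * - cosS (2 ℕ.* m) ∎)
  where
  f₀ = ofℕ ((2 ℕ.* m) !)
  a₁ = ofℕ (suc (2 ℕ.* m))
  a₂ = ofℕ (suc (suc (2 ℕ.* m)))
  c₂ = cosS (suc (suc (2 ℕ.* m)))

secUpTo-values : ∀ n → secUpTo n ≡ applyUpTo (λ i → secS (n ∸ i)) (suc n)
secUpTo-values zero = refl
secUpTo-values (suc n) = cong (secS (suc n) ∷_) (secUpTo-values n)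

sec-recursion : ∀ n → secS (suc n) ≡ - Σ (suc n) (λ j → cosS (suc j) * secS (n ∸ j))
sec-recursion n = cong -_ (begin
  sumℚ (zipWith (λ j s → cosS (suc j) * s) (upTo (suc n)) (secUpTo n))
    ≡⟨ cong (sumℚ ∘ zipWith (λ j s → cosS (suc j) * s) (upTo (suc n))) (secUpTo-values n) ⟩
  sumℚ (zipWith (λ j s → cosS (suc j) * s) (upTo (suc n)) (applyUpTo (λ i → secS (n ∸ i)) (suc n)))
    ≡⟨ cong sumℚ (zipWith-applyUpTo (λ j s → cosS (suc j) * s) id (λ i → secS (n ∸ i)) (suc n)) ⟩
  sumℚ (applyUpTo (λ j → cosS (suc j) * secS (n ∸ j)) (suc n))
    ≡⟨ sum-applyUpTo (suc n) _ ⟩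
  Σ (suc n) (λ j → cosS (suc j) * secS (n ∸ j)) ∎)

δ : PS1
δ zero = 1ℚ
δ (suc n) = 0ℚ

cos✶sec : (cosS ✶ secS) ≗₁ δ
cos✶sec zero = refl
cos✶sec (suc n) = begin
  Σ (suc (suc n)) (λ j → cosS j * secS (suc n ∸ j))   ≡⟨ Σ-front (suc n) _ ⟩
  1ℚ * secS (suc n) + X                                ≡⟨ cong (λ u → 1ℚ * u + X) (sec-recursion n) ⟩
  1ℚ * (- X) + X                                       ≡⟨ solve 1 (λ x → con 1ℚ :* (:- x) :+ x := con 0ℚ) refl X ⟩
  0ℚ                                                   ∎
  where
  X = Σ (suc n) (λ j → cosS (suc j) * secS (n ∸ j))

-- Strong induction on n (bounded by N): every term of the recursion for an
-- odd index has an odd cosine index or an odd smaller secant index.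
sec-even-below : ∀ N n → n ℕ.< N → half n ≡ nothing → secS n ≡ 0ℚ
sec-even-below (suc N) (suc n) (ℕ.s≤s n<N) eq = begin
  secS (suc n)                                        ≡⟨ sec-recursion n ⟩
  - Σ (suc n) (λ j → cosS (suc j) * secS (n ∸ j))     ≡⟨ cong -_ (Σ-cong (suc n) term-vanishes) ⟩
  - Σ (suc n) (λ _ → 0ℚ)                              ≡⟨ cong -_ (Σ-0 (suc n)) ⟩
  0ℚ                                                  ∎
  where
  term-vanishes : ∀ j → j ℕ.< suc n → cosS (suc j) * secS (n ∸ j) ≡ 0ℚ
  term-vanishes j (ℕ.s≤s j≤n) with half-+ (suc j) (n ∸ j) (trans (cong (half ∘ suc) (ℕP.m+[n∸m]≡n j≤n)) eq)
  ... | inj₁ odd-j = trans (cong (_* secS (n ∸ j)) (cos-even (suc j) odd-j)) (ℚP.*-zeroˡ (secS (n ∸ j)))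
  ... | inj₂ odd-n-j = trans (cong (cosS (suc j) *_) (sec-even-below N (n ∸ j) (ℕP.≤-<-trans (ℕP.m∸n≤m n j) n<N) odd-n-j))
                             (ℚP.*-zeroʳ (cosS (suc j)))

sec-even : Even₁ secS
sec-even n = sec-even-below (suc n) n ℕP.≤-refl

secSum sec²Sum cosDiff cos′Diff Ptan Psec : PS2
secSum = atSum secS
sec²Sum = secSum ⊛ secSum
cosDiff = atDiff cosS
cos′Diff = atDiff (∂ cosS)
Ptan = secSum ⊛ cosDiff
Psec = sec²Sum ⊛ cosDiff

L-sec²Sum : L sec²Sum ≈₂ 𝟘
L-sec²Sum a b = trans (L-⊛-constant secSum (L-atSum secS) secSum a b)
  (trans (⊛-congʳ secSum (L-atSum secS) a b) (⊛-𝟘ʳ secSum a b))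

L-cos′Diff : L cos′Diff ≈₂ ((- two) · cosDiff)
L-cos′Diff a b = begin
  L cos′Diff a b                         ≡⟨ L-atDiff (∂ cosS) a b ⟩
  two * atDiff (∂ (∂ cosS)) a b          ≡⟨ cong (two *_) (atDiff-cong ∂∂cos a b) ⟩
  two * atDiff (λ n → - cosS n) a b      ≡⟨ solve 4 (λ t f c s → t :* (((:- f) :* c) :* s) := (:- t) :* ((f :* c) :* s)) refl
                                              two (cosS (a ℕ.+ b)) (ofℕ ((a ℕ.+ b) C a)) (ι (sgn b)) ⟩
  (- two) * cosDiff a b                  ∎

L²-cos-multiple : ∀ G → L G ≈₂ 𝟘 → ∀ a b → L (L (G ⊛ cosDiff)) a b ≡ - (four * (G ⊛ cosDiff) a b)
L²-cos-multiple G LG≈𝟘 a b = begin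
  L (L (G ⊛ cosDiff)) a b            ≡⟨ L-cong L-first a b ⟩
  L (two · (G ⊛ cos′Diff)) a b       ≡⟨ L-· two (G ⊛ cos′Diff) a b ⟩
  two * L (G ⊛ cos′Diff) a b         ≡⟨ cong (two *_) (L-⊛-constant G LG≈𝟘 cos′Diff a b) ⟩
  two * (G ⊛ L cos′Diff) a b         ≡⟨ cong (two *_) (⊛-congʳ G L-cos′Diff a b) ⟩
  two * (G ⊛ ((- two) · cosDiff)) a b ≡⟨ cong (two *_) (⊛-·ʳ (- two) G cosDiff a b) ⟩
  two * ((- two) * (G ⊛ cosDiff) a b) ≡⟨ solve 1 (λ x → con two :* ((:- con two) :* x) := :- (con four :* x)) refl ((G ⊛ cosDiff) a b) ⟩
  - (four * (G ⊛ cosDiff) a b)       ∎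
  where
  L-first : L (G ⊛ cosDiff) ≈₂ (two · (G ⊛ cos′Diff))
  L-first a b = trans (L-⊛-constant G LG≈𝟘 cosDiff a b)
    (trans (⊛-congʳ G (L-atDiff cosS) a b) (⊛-·ʳ two G cos′Diff a b))

Even₂ : PS2 → Set
Even₂ F = ∀ a b → half (a ℕ.+ b) ≡ nothing → F a b ≡ 0ℚ

atSum-even : ∀ F → Even₁ F → Even₂ (atSum F)
atSum-even F F-even a b odd-degree = trans (cong (_* ofℕ ((a ℕ.+ b) C a)) (F-even (a ℕ.+ b) odd-degree)) (ℚP.*-zeroˡ (ofℕ ((a ℕ.+ b) C a)))

atDiff-even : ∀ F → Even₁ F → Even₂ (atDiff F)
atDiff-even F F-even a b odd-degree = trans (cong (_* ι (sgn b)) (atSum-even F F-even a b odd-degree)) (ℚP.*-zeroˡ (ι (sgn b)))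

⊛-even : ∀ F G → Even₂ F → Even₂ G → Even₂ (F ⊛ G)
⊛-even F G F-even G-even a b odd-degree = trans (⊛-Σ F G a b) (trans
  (Σ-cong (suc a) (λ i i≤a → Σ-cong (suc b) (λ j j≤b → term-vanishes i j i≤a j≤b)))
  (Σ²-0 (suc a) (suc b)))
  where
  degrees : ∀ i j → i ℕ.≤ a → j ℕ.≤ b → (i ℕ.+ j) ℕ.+ ((a ∸ i) ℕ.+ (b ∸ j)) ≡ a ℕ.+ b
  degrees i j i≤a j≤b = trans
    (ℕS.solve 4 (λ i j x y → (i ℕS.:+ j) ℕS.:+ (x ℕS.:+ y) ℕS.:= (i ℕS.:+ x) ℕS.:+ (j ℕS.:+ y)) refl i j (a ∸ i) (b ∸ j))
    (cong₂ ℕ._+_ (ℕP.m+[n∸m]≡n i≤a) (ℕP.m+[n∸m]≡n j≤b))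
  term-vanishes : ∀ i j → i ℕ.< suc a → j ℕ.< suc b → F i j * G (a ∸ i) (b ∸ j) ≡ 0ℚ
  term-vanishes i j (ℕ.s≤s i≤a) (ℕ.s≤s j≤b)
    with half-+ (i ℕ.+ j) ((a ∸ i) ℕ.+ (b ∸ j)) (trans (cong half (degrees i j i≤a j≤b)) odd-degree)
  ... | inj₁ odd₁ = trans (cong (_* G (a ∸ i) (b ∸ j)) (F-even i j odd₁)) (ℚP.*-zeroˡ (G (a ∸ i) (b ∸ j)))
  ... | inj₂ odd₂ = trans (cong (F i j *_) (G-even (a ∸ i) (b ∸ j) odd₂)) (ℚP.*-zeroʳ (F i j))

Ptan-even : Even₂ Ptan
Ptan-even = ⊛-even secSum cosDiff (atSum-even secS sec-even) (atDiff-even cosS cos-even)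

Psec-even : Even₂ Psec
Psec-even = ⊛-even sec²Sum cosDiff (⊛-even secSum secSum (atSum-even secS sec-even) (atSum-even secS sec-even)) (atDiff-even cosS cos-even)

-- Symmetry under x ↔ y.  For F(x−y) it needs F even, because then
-- (−1)ᵃ = (−1)ᵇ on every nonzero coefficient.
Symmetric : PS2 → Set
Symmetric F = swap F ≈₂ F

sgn-+ : ∀ a b → sgn (a ℕ.+ b) ≡ sgn a ℤ.* sgn b
sgn-+ zero b = sym (ℤP.*-identityˡ (sgn b))
sgn-+ (suc a) b = trans (cong ℤ.-_ (sgn-+ a b)) (ℤP.neg-distribˡ-* (sgn a) (sgn b))

sgn-square : ∀ a → sgn a ℤ.* sgn a ≡ + 1
sgn-square zero = refl
sgn-square (suc a) = trans (ℤS.solve 1 (λ x → (ℤS.:- x) ℤS.:* (ℤS.:- x) ℤS.:= x ℤS.:* x) refl (sgn a)) (sgn-square a)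

sgn-even-sum : ∀ a b {m} → half (a ℕ.+ b) ≡ just m → sgn a ≡ sgn b
sgn-even-sum a b {m} even-degree = begin
  sgn a                        ≡⟨ sym (ℤP.*-identityʳ (sgn a)) ⟩
  sgn a ℤ.* + 1                ≡⟨ cong (sgn a ℤ.*_) (sym sgn[a+b]≡1) ⟩
  sgn a ℤ.* sgn (a ℕ.+ b)      ≡⟨ cong (sgn a ℤ.*_) (sgn-+ a b) ⟩
  sgn a ℤ.* (sgn a ℤ.* sgn b)  ≡⟨ sym (ℤP.*-assoc (sgn a) (sgn a) (sgn b)) ⟩
  (sgn a ℤ.* sgn a) ℤ.* sgn b  ≡⟨ cong (ℤ._* sgn b) (sgn-square a) ⟩
  + 1 ℤ.* sgn b                ≡⟨ ℤP.*-identityˡ (sgn b) ⟩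
  sgn b                        ∎
  where
  sgn[a+b]≡1 : sgn (a ℕ.+ b) ≡ + 1
  sgn[a+b]≡1 = trans (cong sgn (half-just (a ℕ.+ b) even-degree))
    (trans (sgn-+ m (m ℕ.+ 0)) (trans (cong (λ k → sgn m ℤ.* sgn k) (ℕP.+-identityʳ m)) (sgn-square m)))

atDiff-symmetric : ∀ F → Even₁ F → Symmetric (atDiff F)
atDiff-symmetric F F-even a b with half (a ℕ.+ b) in eq
... | nothing = trans (atDiff-even F F-even b a (trans (cong half (ℕP.+-comm b a)) eq))
                      (sym (atDiff-even F F-even a b eq))
... | just m = cong₂ _*_ (swap-atSum F a b) (cong ι (sgn-even-sum a b eq))

⊛-symmetric : ∀ F G → Symmetric F → Symmetric G → Symmetric (F ⊛ G)
⊛-symmetric F G F-sym G-sym a b = trans (swap-⊛ F G a b) (⊛-cong {swap F} {F} {swap G} {G} F-sym G-sym a b)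

Ptan-symmetric : Symmetric Ptan
Ptan-symmetric = ⊛-symmetric secSum cosDiff (swap-atSum secS) (atDiff-symmetric cosS cos-even)

Psec-symmetric : Symmetric Psec
Psec-symmetric = ⊛-symmetric sec²Sum cosDiff (⊛-symmetric secSum secSum (swap-atSum secS) (swap-atSum secS)) (atDiff-symmetric cosS cos-even)

-- Algebra of the one-variable product.  Associativity is derived from the
-- Leibniz rule: both sides have equal derivatives and equal constant terms.
✶-cong : ∀ {p p′ q q′} → p ≗₁ p′ → q ≗₁ q′ → (p ✶ q) ≗₁ (p′ ✶ q′)
✶-cong e₁ e₂ n = Σ-cong′ (suc n) (λ i → cong₂ _*_ (e₁ i) (e₂ (n ∸ i)))

✶-congˡ : ∀ {p p′} q → p ≗₁ p′ → (p ✶ q) ≗₁ (p′ ✶ q)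
✶-congˡ q e = ✶-cong e (λ n → refl {x = q n})

✶-congʳ : ∀ p {q q′} → q ≗₁ q′ → (p ✶ q) ≗₁ (p ✶ q′)
✶-congʳ p e = ✶-cong (λ n → refl {x = p n}) e

✶-comm : ∀ p q → (p ✶ q) ≗₁ (q ✶ p)
✶-comm p q n = trans (Σ-reverse (suc n) (λ i → p i * q (n ∸ i)))
  (Σ-cong (suc n) (λ i i≤n → trans (cong (λ k → p (n ∸ i) * q k) (ℕP.m∸[m∸n]≡n (ℕP.≤-pred i≤n)))
                                   (ℚP.*-comm (p (n ∸ i)) (q i))))

✶-+ˡ : ∀ p q r n → ((λ k → p k + q k) ✶ r) n ≡ (p ✶ r) n + (q ✶ r) n
✶-+ˡ p q r n = trans (Σ-cong′ (suc n) (λ i → ℚP.*-distribʳ-+ (r (n ∸ i)) (p i) (q i))) (Σ-+ (suc n) _ _)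

✶-+ʳ : ∀ p q r n → (p ✶ (λ k → q k + r k)) n ≡ (p ✶ q) n + (p ✶ r) n
✶-+ʳ p q r n = trans (Σ-cong′ (suc n) (λ i → ℚP.*-distribˡ-+ (p i) (q (n ∸ i)) (r (n ∸ i)))) (Σ-+ (suc n) _ _)

✶-·ˡ : ∀ c p q n → ((λ k → c * p k) ✶ q) n ≡ c * (p ✶ q) n
✶-·ˡ c p q n = trans (Σ-cong′ (suc n) (λ i → ℚP.*-assoc c (p i) (q (n ∸ i)))) (sym (Σ-*ˡ (suc n) c _))

✶-negʳ : ∀ p q n → (p ✶ (λ k → - q k)) n ≡ - (p ✶ q) n
✶-negʳ p q n = trans (Σ-cong′ (suc n) (λ i → sym (ℚP.neg-distribʳ-* (p i) (q (n ∸ i))))) (sym (Σ-neg (suc n) _))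

✶-0ʳ : ∀ p n → (p ✶ (λ _ → 0ℚ)) n ≡ 0ℚ
✶-0ʳ p n = trans (Σ-cong′ (suc n) (λ i → ℚP.*-zeroʳ (p i))) (Σ-0 (suc n))

✶-assoc : ∀ n p q r → ((p ✶ q) ✶ r) n ≡ (p ✶ (q ✶ r)) n
✶-assoc zero p q r =
  solve 3 (λ x y z → con 0ℚ :+ (con 0ℚ :+ x :* y) :* z := con 0ℚ :+ x :* (con 0ℚ :+ y :* z)) refl (p 0) (q 0) (r 0)
✶-assoc (suc n) p q r = *-cancelˡ-suc n _ _ (begin
  ∂ ((p ✶ q) ✶ r) n
    ≡⟨ ∂-✶ (p ✶ q) r n ⟩
  (∂ (p ✶ q) ✶ r) n + ((p ✶ q) ✶ ∂ r) n
    ≡⟨ cong (_+ ((p ✶ q) ✶ ∂ r) n) (trans (✶-congˡ r (∂-✶ p q) n) (✶-+ˡ (∂ p ✶ q) (p ✶ ∂ q) r n)) ⟩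
  (((∂ p ✶ q) ✶ r) n + ((p ✶ ∂ q) ✶ r) n) + ((p ✶ q) ✶ ∂ r) n
    ≡⟨ cong₂ _+_ (cong₂ _+_ (✶-assoc n (∂ p) q r) (✶-assoc n p (∂ q) r)) (✶-assoc n p q (∂ r)) ⟩
  ((∂ p ✶ (q ✶ r)) n + (p ✶ (∂ q ✶ r)) n) + (p ✶ (q ✶ ∂ r)) n
    ≡⟨ ℚP.+-assoc ((∂ p ✶ (q ✶ r)) n) _ _ ⟩
  (∂ p ✶ (q ✶ r)) n + ((p ✶ (∂ q ✶ r)) n + (p ✶ (q ✶ ∂ r)) n)
    ≡⟨ cong (_+_ ((∂ p ✶ (q ✶ r)) n)) (sym (trans (✶-congʳ p (∂-✶ q r) n) (✶-+ʳ p (∂ q ✶ r) (q ✶ ∂ r) n))) ⟩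
  (∂ p ✶ (q ✶ r)) n + (p ✶ ∂ (q ✶ r)) n
    ≡⟨ sym (∂-✶ p (q ✶ r) n) ⟩
  ∂ (p ✶ (q ✶ r)) n ∎)

atY0 : PS2 → PS1
atY0 F a = F a 0

⊛-atY0 : ∀ F G a → (F ⊛ G) a 0 ≡ (atY0 F ✶ atY0 G) a
⊛-atY0 F G a = trans (⊛-Σ F G a 0) (Σ-cong′ (suc a) (λ i → ℚP.+-identityˡ (F i 0 * G (a ∸ i) 0)))

atSum-atY0 : ∀ F → atY0 (atSum F) ≗₁ F
atSum-atY0 F a = trans (cong₂ (λ x y → F x * ofℕ (y C a)) (ℕP.+-identityʳ a) (ℕP.+-identityʳ a))
  (trans (cong (λ k → F a * ofℕ k) (nCn≡1 a)) (ℚP.*-identityʳ (F a)))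

atDiff-atY0 : ∀ F → atY0 (atDiff F) ≗₁ F
atDiff-atY0 F a = trans (ℚP.*-identityʳ (atSum F a 0)) (atSum-atY0 F a)

sec✶cos : (secS ✶ cosS) ≗₁ δ
sec✶cos n = trans (✶-comm secS cosS n) (cos✶sec n)

Ptan-atY0 : ∀ a → Ptan a 0 ≡ δ a
Ptan-atY0 a = trans (⊛-atY0 secSum cosDiff a)
  (trans (✶-cong (atSum-atY0 secS) (atDiff-atY0 cosS) a) (sec✶cos a))

-- Writing U(x) = sec² x, X = U′ cos and
-- Y = U cos′, one has ∂x Psec(x,0) = X + Y, ∂y Psec(x,0) = X − Y, and
-- X + 2Y = 2 sec · (sec cos)′ = 0; hence ∂y Psec(x,0) = 3 ∂x Psec(x,0).
module SecantBoundary where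
  U X Y : PS1
  U = atY0 sec²Sum
  X = ∂ U ✶ cosS
  Y = U ✶ ∂ cosS

  U≗sec✶sec : U ≗₁ (secS ✶ secS)
  U≗sec✶sec k = trans (⊛-atY0 secSum secSum k) (✶-cong (atSum-atY0 secS) (atSum-atY0 secS) k)

  ∂x-Psec : ∀ a → ∂x Psec a 0 ≡ X a + Y a
  ∂x-Psec a = trans (∂x-⊛ sec²Sum cosDiff a 0) (cong₂ _+_
    (trans (⊛-atY0 (∂x sec²Sum) cosDiff a) (✶-congʳ (∂ U) (atDiff-atY0 cosS) a))
    (trans (⊛-atY0 sec²Sum (∂x cosDiff) a) (✶-congʳ U (λ k → trans (∂x-atDiff cosS k 0) (atDiff-atY0 (∂ cosS) k)) a)))

  ∂y-Psec : ∀ a → ∂y Psec a 0 ≡ X a - Y a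
  ∂y-Psec a = trans (∂y-⊛ sec²Sum cosDiff a 0) (cong₂ _+_
    (trans (⊛-atY0 (∂y sec²Sum) cosDiff a) (✶-cong ∂y≡∂x (atDiff-atY0 cosS) a))
    (trans (⊛-atY0 sec²Sum (∂y cosDiff) a)
      (trans (✶-congʳ U (λ k → trans (∂y-atDiff cosS k 0) (cong -_ (atDiff-atY0 (∂ cosS) k))) a)
        (✶-negʳ U (∂ cosS) a))))
    where
    -- L sec²Sum = 0 means ∂x sec²Sum = ∂y sec²Sum.
    ∂y≡∂x : ∀ k → ∂y sec²Sum k 0 ≡ ∂ U k
    ∂y≡∂x k = sym (trans (solve 2 (λ x y → x := (x :- y) :+ y) refl (∂x sec²Sum k 0) (∂y sec²Sum k 0))
      (trans (cong (_+ ∂y sec²Sum k 0) (L-sec²Sum k 0)) (ℚP.+-identityˡ (∂y sec²Sum k 0))))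

  X+2Y≡0 : ∀ a → X a + two * Y a ≡ 0ℚ
  X+2Y≡0 a = begin
    X a + two * Y a
      ≡⟨ cong₂ (λ u v → u + two * v)
           (trans (✶-congˡ c ∂U≗2sec✶∂sec a) (trans (✶-·ˡ two (s ✶ ∂ s) c a) (cong (two *_) (✶-assoc a s (∂ s) c))))
           (trans (✶-congˡ (∂ c) U≗sec✶sec a) (✶-assoc a s s (∂ c))) ⟩
    two * (s ✶ (∂ s ✶ c)) a + two * (s ✶ (s ✶ ∂ c)) a
      ≡⟨ sym (trans (cong (two *_) (✶-+ʳ s (∂ s ✶ c) (s ✶ ∂ c) a)) (ℚP.*-distribˡ-+ two ((s ✶ (∂ s ✶ c)) a) ((s ✶ (s ✶ ∂ c)) a))) ⟩
    two * (s ✶ (λ k → (∂ s ✶ c) k + (s ✶ ∂ c) k)) a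
      ≡⟨ cong (two *_) (✶-congʳ s (λ k → trans (sym (∂-✶ s c k)) (∂[sec✶cos]≡0 k)) a) ⟩
    two * (s ✶ (λ _ → 0ℚ)) a
      ≡⟨ trans (cong (two *_) (✶-0ʳ s a)) (ℚP.*-zeroʳ two) ⟩
    0ℚ ∎
    where
    s = secS
    c = cosS
    ∂U≗2sec✶∂sec : ∂ U ≗₁ (λ k → two * (s ✶ ∂ s) k)
    ∂U≗2sec✶∂sec k = trans (cong (ofℕ (suc k) *_) (U≗sec✶sec (suc k))) (trans (∂-✶ s s k)
      (trans (cong (_+ (s ✶ ∂ s) k) (✶-comm (∂ s) s k)) (solve 1 (λ x → x :+ x := con two :* x) refl ((s ✶ ∂ s) k))))
    ∂[sec✶cos]≡0 : ∀ k → ∂ (s ✶ c) k ≡ 0ℚ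
    ∂[sec✶cos]≡0 k = trans (cong (ofℕ (suc k) *_) (sec✶cos (suc k))) (ℚP.*-zeroʳ (ofℕ (suc k)))

  Psec-∂y≡3∂x : ∀ a → ∂y Psec a 0 ≡ three * ∂x Psec a 0
  Psec-∂y≡3∂x a = begin
    ∂y Psec a 0                                    ≡⟨ ∂y-Psec a ⟩
    X a - Y a                                      ≡⟨ solve 2 (λ x y → x :- y := con three :* (x :+ y) :- con two :* (x :+ con two :* y)) refl (X a) (Y a) ⟩
    three * (X a + Y a) - two * (X a + two * Y a)  ≡⟨ cong₂ (λ u v → three * u - two * v) (sym (∂x-Psec a)) (X+2Y≡0 a) ⟩
    three * ∂x Psec a 0 - two * 0ℚ                 ≡⟨ solve 1 (λ z → con three :* z :- con two :* con 0ℚ := con three :* z) refl (∂x Psec a 0) ⟩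
    three * ∂x Psec a 0                            ∎

open SecantBoundary using (Psec-∂y≡3∂x)

scaled : PS2 → ℕ → ℕ → ℚ
scaled P a b = P a b * ofℕ (a ! ℕ.* b !)

-- The recurrence of the families, in the coordinates a = 2n−k−1, b = k−1.
StepRecurrence : (ℕ → ℕ → ℚ) → Set
StepRecurrence Q = ∀ a b → Q a (suc (suc b)) ≡ (two * Q (suc a) (suc b) - Q (suc (suc a)) b) - four * Q a b

factorial-weightˡ : ∀ m n → ofℕ (suc m ! ℕ.* n !) ≡ ofℕ (suc m) * ofℕ (m ! ℕ.* n !)
factorial-weightˡ m n = trans (cong ofℕ (ℕP.*-assoc (suc m) (m !) (n !))) (ofℕ-* (suc m) (m ! ℕ.* n !))

factorial-weightʳ : ∀ m n → ofℕ (m ! ℕ.* suc n !) ≡ ofℕ (suc n) * ofℕ (m ! ℕ.* n !)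
factorial-weightʳ m n = trans (cong ofℕ
  (ℕS.solve 3 (λ x y z → x ℕS.:* (y ℕS.:* z) ℕS.:= y ℕS.:* (x ℕS.:* z)) refl (m !) (suc n) (n !)))
  (ofℕ-* (suc n) (m ! ℕ.* n !))

-- L² P = −4 P becomes the step recurrence for the rescaled coefficients,
-- because L²P(a,b) = (a+1)(a+2)P(a+2,b) − 2(a+1)(b+1)P(a+1,b+1) + (b+1)(b+2)P(a,b+2).
scaled-step : ∀ P → (∀ a b → L (L P) a b ≡ - (four * P a b)) → StepRecurrence (scaled P)
scaled-step P L²P≡-4P a b = begin
  p₀₂ * ofℕ (a ! ℕ.* suc (suc b) !)
    ≡⟨ cong (p₀₂ *_) (trans (factorial-weightʳ a (suc b)) (cong (B₂ *_) (factorial-weightʳ a b))) ⟩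
  p₀₂ * (B₂ * (B₁ * w))
    ≡⟨ solve 9 (λ p₀₂ p₁₁ p₂₀ p₀₀ A₁ A₂ B₁ B₂ w →
          p₀₂ :* (B₂ :* (B₁ :* w)) :=
          ((con two :* (p₁₁ :* (A₁ :* (B₁ :* w))) :- p₂₀ :* (A₂ :* (A₁ :* w))) :- con four :* (p₀₀ :* w))
          :+ w :* ((A₁ :* (A₂ :* p₂₀ :- B₁ :* p₁₁) :- B₁ :* (A₁ :* p₁₁ :- B₂ :* p₀₂)) :+ con four :* p₀₀))
         refl p₀₂ p₁₁ p₂₀ p₀₀ A₁ A₂ B₁ B₂ w ⟩
  rhs + w * (L (L P) a b + four * p₀₀)
    ≡⟨ cong (λ z → rhs + w * (z + four * p₀₀)) (L²P≡-4P a b) ⟩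
  rhs + w * (- (four * p₀₀) + four * p₀₀)
    ≡⟨ solve 3 (λ r w z → r :+ w :* ((:- z) :+ z) := r) refl rhs w (four * p₀₀) ⟩
  rhs
    ≡⟨ sym (cong₂ (λ u v → (two * (p₁₁ * u) - p₂₀ * v) - four * (p₀₀ * w))
          (trans (factorial-weightˡ a (suc b)) (cong (A₁ *_) (factorial-weightʳ a b)))
          (trans (factorial-weightˡ (suc a) b) (cong (A₂ *_) (factorial-weightˡ a b)))) ⟩
  (two * scaled P (suc a) (suc b) - scaled P (suc (suc a)) b) - four * scaled P a b ∎
  where
  p₀₂ = P a (suc (suc b))
  p₁₁ = P (suc a) (suc b)
  p₂₀ = P (suc (suc a)) b
  p₀₀ = P a b
  A₁ = ofℕ (suc a)
  A₂ = ofℕ (suc (suc a))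
  B₁ = ofℕ (suc b)
  B₂ = ofℕ (suc (suc b))
  w = ofℕ (a ! ℕ.* b !)
  rhs = (two * (p₁₁ * (A₁ * (B₁ * w))) - p₂₀ * (A₂ * (A₁ * w))) - four * (p₀₀ * w)

scaled-symmetric : ∀ P → Symmetric P → ∀ a b → scaled P b a ≡ scaled P a b
scaled-symmetric P P-sym a b = cong₂ (λ u v → u * ofℕ v) (P-sym a b) (ℕP.*-comm (b !) (a !))

antidiagonal : (ℕ → ℕ → ℚ) → ℕ → ℚ
antidiagonal Q N = Σ (suc N) (λ i → Q (N ∸ i) i)

-- For a symmetric solution of the step recurrence, the recurrence summed
-- along the antidiagonal a+b = N telescopes to the boundary terms.
antidiagonal-identity : ∀ Q → StepRecurrence Q → (∀ a b → Q b a ≡ Q a b) → ∀ N →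
  four * antidiagonal Q N ≡ two * Q (suc N) 1 - two * Q (suc (suc N)) 0
antidiagonal-identity Q step Q-sym N = begin
  four * antidiagonal Q N
    ≡⟨ trans (Σ-*ˡ (suc N) four _) (solve 1 (λ x → x := :- (:- x)) refl _) ⟩
  - (- Σ (suc N) (λ i → four * Q (N ∸ i) i))
    ≡⟨ cong -_ (trans (Σ-neg (suc N) _) (sym (Σ-cong (suc N) second-difference))) ⟩
  - Σ (suc N) (λ i → (t i - two * t (suc i)) + t (suc (suc i)))
    ≡⟨ cong -_ (Σ-second-difference N t) ⟩
  - (((t 0 - t 1) - t (suc N)) + t (suc (suc N)))
    ≡⟨ cong₂ (λ u v → - (((t 0 - t 1) - u) + v))
         (trans (cong (λ k → Q k (suc N)) (trans (ℕP.+-∸-assoc 1 (ℕP.≤-refl {N})) (cong suc (ℕP.n∸n≡0 N)))) (Q-sym (suc N) 1))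
         (trans (cong (λ k → Q k (suc (suc N))) (ℕP.n∸n≡0 N)) (Q-sym (suc (suc N)) 0)) ⟩
  - (((Q (suc (suc N)) 0 - Q (suc N) 1) - Q (suc N) 1) + Q (suc (suc N)) 0)
    ≡⟨ solve 2 (λ x y → :- (((x :- y) :- y) :+ x) := con two :* y :- con two :* x) refl (Q (suc (suc N)) 0) (Q (suc N) 1) ⟩
  two * Q (suc N) 1 - two * Q (suc (suc N)) 0 ∎
  where
  t : ℕ → ℚ
  t i = Q (suc (suc N) ∸ i) i
  second-difference : ∀ i → i ℕ.< suc N → (t i - two * t (suc i)) + t (suc (suc i)) ≡ - (four * Q (N ∸ i) i)
  second-difference i (ℕ.s≤s i≤N)
    rewrite ℕP.+-∸-assoc 2 i≤N | ℕP.+-∸-assoc 1 i≤N | step (N ∸ i) i =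
    solve 3 (λ x y z → (x :- con two :* y) :+ ((con two :* y :- x) :- con four :* z) := :- (con four :* z)) refl
      (Q (suc (suc (N ∸ i))) i) (Q (suc (N ∸ i)) (suc i)) (Q (N ∸ i) i)

Qtan Qsec : ℕ → ℕ → ℚ
Qtan = scaled Ptan
Qsec = scaled Psec

Qtan-step : StepRecurrence Qtan
Qtan-step = scaled-step Ptan (L²-cos-multiple secSum (L-atSum secS))

Qsec-step : StepRecurrence Qsec
Qsec-step = scaled-step Psec (L²-cos-multiple sec²Sum L-sec²Sum)

tan-boundary : ∀ N → Qtan (suc (suc N)) 0 ≡ 0ℚ × Qtan (suc N) 1 ≡ two * antidiagonal Qtan N
tan-boundary N = Q₀≡0 , *-cancelˡ-suc 1 _ _ (begin
  two * q₁                           ≡⟨ solve 2 (λ x y → con two :* x := (con two :* x :- con two :* y) :+ con two :* y) refl q₁ q₀ ⟩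
  (two * q₁ - two * q₀) + two * q₀    ≡⟨ cong₂ (λ u v → u + two * v)
                                          (sym (antidiagonal-identity Qtan Qtan-step (scaled-symmetric Ptan Ptan-symmetric) N)) Q₀≡0 ⟩
  four * R + two * 0ℚ                ≡⟨ solve 1 (λ r → con four :* r :+ con two :* con 0ℚ := con two :* (con two :* r)) refl R ⟩
  two * (two * R)                    ∎)
  where
  q₀ = Qtan (suc (suc N)) 0
  q₁ = Qtan (suc N) 1
  R = antidiagonal Qtan N
  Q₀≡0 : q₀ ≡ 0ℚ
  Q₀≡0 = trans (cong (_* ofℕ (suc (suc N) ! ℕ.* 1)) (Ptan-atY0 (suc (suc N)))) (ℚP.*-zeroˡ (ofℕ (suc (suc N) ! ℕ.* 1)))

-- In the secant case ∂y P = 3 ∂x P on y = 0 gives Q(a,1) = 3 Q(a+1,0).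
Qsec-boundary-ratio : ∀ a → Qsec a 1 ≡ three * Qsec (suc a) 0
Qsec-boundary-ratio a = begin
  Psec a 1 * w                                 ≡⟨ cong (_* w) (sym (ℚP.*-identityˡ (Psec a 1))) ⟩
  ∂y Psec a 0 * w                              ≡⟨ cong (_* w) (Psec-∂y≡3∂x a) ⟩
  (three * (ofℕ (suc a) * Psec (suc a) 0)) * w
    ≡⟨ solve 4 (λ t x p f → (t :* (x :* p)) :* f := t :* (p :* (x :* f))) refl three (ofℕ (suc a)) (Psec (suc a) 0) w ⟩
  three * (Psec (suc a) 0 * (ofℕ (suc a) * w))
    ≡⟨ cong (λ z → three * (Psec (suc a) 0 * z)) (sym (factorial-weightˡ a 0)) ⟩
  three * Qsec (suc a) 0                       ∎
  where
  w = ofℕ (a ! ℕ.* 1)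

sec-boundary : ∀ N → Qsec (suc (suc N)) 0 ≡ antidiagonal Qsec N × Qsec (suc N) 1 ≡ three * antidiagonal Qsec N
sec-boundary N = sym R≡q₀ , trans (Qsec-boundary-ratio (suc N)) (cong (three *_) (sym R≡q₀))
  where
  q₀ = Qsec (suc (suc N)) 0
  R = antidiagonal Qsec N
  R≡q₀ : R ≡ q₀
  R≡q₀ = *-cancelˡ-suc 3 _ _ (begin
    four * R                                ≡⟨ antidiagonal-identity Qsec Qsec-step (scaled-symmetric Psec Psec-symmetric) N ⟩
    two * Qsec (suc N) 1 - two * q₀         ≡⟨ cong (λ u → two * u - two * q₀) (Qsec-boundary-ratio (suc N)) ⟩
    two * (three * q₀) - two * q₀           ≡⟨ solve 1 (λ x → con two :* (con three :* x) :- con two :* x := con four :* x) refl q₀ ⟩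
    four * q₀                               ∎)

recurrence-ℚ : ∀ f → Recurrence f → ∀ m k → 1 ℕ.≤ k → k ℕ.≤ 2 ℕ.* m ℕ.+ 1 →
  ι (f (suc (suc m)) (k ℕ.+ 2)) ≡ (two * ι (f (suc (suc m)) (k ℕ.+ 1)) - ι (f (suc (suc m)) k)) - four * ι (f (suc m) k)
recurrence-ℚ f rec m k 1≤k k≤2m+1 = begin
  x ≡⟨ solve 4 (λ x y z w → x := (((con two :* y :- z) :- con four :* w) :+ (((x :- con two :* y) :+ z) :+ con four :* w))) refl x y z w ⟩
  ((two * y - z) - four * w) + (((x - two * y) + z) + four * w) ≡⟨ cong (_+_ ((two * y - z) - four * w)) in-ℚ ⟩
  ((two * y - z) - four * w) + 0ℚ                               ≡⟨ ℚP.+-identityʳ _ ⟩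
  (two * y - z) - four * w                                       ∎
  where
  X = f (suc (suc m)) (k ℕ.+ 2)
  Y = f (suc (suc m)) (k ℕ.+ 1)
  Z′ = f (suc (suc m)) k
  W = f (suc m) k
  x = ι X
  y = ι Y
  z = ι Z′
  w = ι W
  in-ℚ : ((x - two * y) + z) + four * w ≡ 0ℚ
  in-ℚ = begin
    ((x - two * y) + z) + four * w
      ≡⟨ sym (cong₂ _+_ (trans (ι-+ (X ℤ.- (+ 2) ℤ.* Y) Z′)
                               (cong (_+ z) (trans (ι-+ X (ℤ.- ((+ 2) ℤ.* Y))) (cong (_+_ x) (trans (ι-neg ((+ 2) ℤ.* Y)) (cong -_ (ι-* (+ 2) Y)))))))
                        (ι-* (+ 4) W)) ⟩
    ι ((X ℤ.- (+ 2) ℤ.* Y) ℤ.+ Z′) + ι ((+ 4) ℤ.* W)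
      ≡⟨ sym (ι-+ ((X ℤ.- (+ 2) ℤ.* Y) ℤ.+ Z′) ((+ 4) ℤ.* W)) ⟩
    ι (((X ℤ.- (+ 2) ℤ.* Y) ℤ.+ Z′) ℤ.+ (+ 4) ℤ.* W)
      ≡⟨ cong ι (rec m k 1≤k k≤2m+1) ⟩
    0ℚ ∎

-- Row n of a family (values f_{n+1}(b+1), 2n = a+b) agrees with the
-- antidiagonal a+b = 2n of Q.
AgreesOnRow : (ℕ → ℕ → ℤ) → (ℕ → ℕ → ℚ) → ℕ → Set
AgreesOnRow f Q n = ∀ a b → a ℕ.+ b ≡ 2 ℕ.* n → ι (f (suc n) (suc b)) ≡ Q a b

BoundaryAgreement : (ℕ → ℕ → ℤ) → (ℕ → ℕ → ℚ) → Set
BoundaryAgreement f Q = ∀ m → AgreesOnRow f Q m →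
  ι (f (suc (suc m)) 1) ≡ Q (suc (suc (2 ℕ.* m))) 0 × ι (f (suc (suc m)) 2) ≡ Q (suc (2 ℕ.* m)) 1

next-row : ∀ f Q → Recurrence f → StepRecurrence Q → BoundaryAgreement f Q →
  ∀ m → AgreesOnRow f Q m → AgreesOnRow f Q (suc m)
next-row f Q rec step boundary m row-m a b a+b≡ = proj₁ (entries b) a a+b≡
  where
  Entry : ℕ → Set
  Entry b = ∀ a → a ℕ.+ b ≡ 2 ℕ.* suc m → ι (f (suc (suc m)) (suc b)) ≡ Q a b
  entry₀ : Entry 0
  entry₀ a e rewrite trans (sym (ℕP.+-identityʳ a)) (trans e (double-suc m)) = proj₁ (boundary m row-m)
  entry₁ : Entry 1
  entry₁ a e rewrite ℕP.suc-injective (trans (ℕP.+-comm 1 a) (trans e (double-suc m))) = proj₂ (boundary m row-m)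
  entry-step : ∀ b → Entry b → Entry (suc b) → Entry (suc (suc b))
  entry-step b entry-b entry-b+1 a e = begin
    ι (f (suc (suc m)) (suc (suc (suc b))))
      ≡⟨ cong (λ k → ι (f (suc (suc m)) k)) (ℕP.+-comm 2 (suc b)) ⟩
    ι (f (suc (suc m)) (suc b ℕ.+ 2))
      ≡⟨ recurrence-ℚ f rec m (suc b) (ℕ.s≤s ℕ.z≤n) b+1≤2m+1 ⟩
    (two * ι (f (suc (suc m)) (suc b ℕ.+ 1)) - ι (f (suc (suc m)) (suc b))) - four * ι (f (suc m) (suc b))
      ≡⟨ cong₂ (λ u v → (two * u - v) - four * ι (f (suc m) (suc b)))
           (trans (cong (λ k → ι (f (suc (suc m)) k)) (ℕP.+-comm (suc b) 1)) (entry-b+1 (suc a) a+1+b+1≡))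
           (entry-b (suc (suc a)) a+2+b≡) ⟩
    (two * Q (suc a) (suc b) - Q (suc (suc a)) b) - four * ι (f (suc m) (suc b))
      ≡⟨ cong (λ u → (two * Q (suc a) (suc b) - Q (suc (suc a)) b) - four * u) (row-m a b a+b≡2m) ⟩
    (two * Q (suc a) (suc b) - Q (suc (suc a)) b) - four * Q a b
      ≡⟨ sym (step a b) ⟩
    Q a (suc (suc b)) ∎
    where
    a+b≡2m : a ℕ.+ b ≡ 2 ℕ.* m
    a+b≡2m = ℕP.suc-injective (ℕP.suc-injective
      (trans (sym (trans (ℕP.+-suc a (suc b)) (cong suc (ℕP.+-suc a b)))) (trans e (double-suc m))))
    a+2+b≡ : suc (suc a) ℕ.+ b ≡ 2 ℕ.* suc m
    a+2+b≡ = trans (cong (suc ∘ suc) a+b≡2m) (sym (double-suc m))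
    a+1+b+1≡ : suc a ℕ.+ suc b ≡ 2 ℕ.* suc m
    a+1+b+1≡ = trans (cong suc (ℕP.+-suc a b)) a+2+b≡
    b+1≤2m+1 : suc b ℕ.≤ 2 ℕ.* m ℕ.+ 1
    b+1≤2m+1 = subst (suc b ℕ.≤_) (ℕP.+-comm 1 (2 ℕ.* m)) (ℕ.s≤s (subst (b ℕ.≤_) a+b≡2m (ℕP.m≤n+m b a)))
  entries : ∀ b → Entry b × Entry (suc b)
  entries zero = entry₀ , entry₁
  entries (suc b) = proj₂ (entries b) , entry-step b (proj₁ (entries b)) (proj₂ (entries b))

family-determined : ∀ f Q → Recurrence f → StepRecurrence Q → ι (f 1 1) ≡ Q 0 0 → BoundaryAgreement f Q →
  ∀ n → AgreesOnRow f Q n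
family-determined f Q rec step base boundary zero a b e
  rewrite ℕP.m+n≡0⇒m≡0 a e | ℕP.m+n≡0⇒n≡0 a e = base
family-determined f Q rec step base boundary (suc m) =
  next-row f Q rec step boundary m (family-determined f Q rec step base boundary m)

rowSum-agrees : ∀ f Q m → AgreesOnRow f Q m → ι (rowSum f (suc m)) ≡ antidiagonal Q (2 ℕ.* m)
rowSum-agrees f Q m row-m = begin
  ι (rowSum f (suc m))
    ≡⟨ ι-foldr (map (λ i → f (suc m) (suc i)) (upTo (2 ℕ.* suc m ∸ 1))) ⟩
  sumℚ (map ι (map (λ i → f (suc m) (suc i)) (upTo (2 ℕ.* suc m ∸ 1))))
    ≡⟨ cong sumℚ (sym (map-∘ (upTo (2 ℕ.* suc m ∸ 1)))) ⟩
  sumℚ (map (λ i → ι (f (suc m) (suc i))) (upTo (2 ℕ.* suc m ∸ 1)))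
    ≡⟨ cong (λ k → sumℚ (map (λ i → ι (f (suc m) (suc i))) (upTo (k ∸ 1)))) (double-suc m) ⟩
  sumℚ (map (λ i → ι (f (suc m) (suc i))) (upTo (suc (2 ℕ.* m))))
    ≡⟨ sum-map-upTo (suc (2 ℕ.* m)) _ ⟩
  Σ (suc (2 ℕ.* m)) (λ i → ι (f (suc m) (suc i)))
    ≡⟨ Σ-cong (suc (2 ℕ.* m)) (λ i i≤2m → row-m (2 ℕ.* m ∸ i) i (ℕP.m∸n+n≡m (ℕP.≤-pred i≤2m))) ⟩
  antidiagonal Q (2 ℕ.* m) ∎
  where
  ι-foldr : ∀ xs → ι (List.foldr ℤ._+_ (+ 0) xs) ≡ sumℚ (map ι xs)
  ι-foldr [] = refl
  ι-foldr (x ∷ xs) = trans (ι-+ x _) (cong (_+_ (ι x)) (ι-foldr xs))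

g-boundary : ∀ g → IsG g → BoundaryAgreement g Qtan
g-boundary g (_ , _ , g₁≡0 , g₂≡2Σ) m row-m =
  trans (cong ι (g₁≡0 m)) (sym (proj₁ (tan-boundary (2 ℕ.* m)))) ,
  (begin
    ι (g (suc (suc m)) 2)               ≡⟨ cong ι (g₂≡2Σ m) ⟩
    ι ((+ 2) ℤ.* rowSum g (suc m))      ≡⟨ ι-* (+ 2) (rowSum g (suc m)) ⟩
    two * ι (rowSum g (suc m))          ≡⟨ cong (two *_) (rowSum-agrees g Qtan m row-m) ⟩
    two * antidiagonal Qtan (2 ℕ.* m)   ≡⟨ sym (proj₂ (tan-boundary (2 ℕ.* m))) ⟩
    Qtan (suc (2 ℕ.* m)) 1              ∎)

h-boundary : ∀ h → IsH h → BoundaryAgreement h Qsec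
h-boundary h (_ , _ , h₁≡Σ , h₂≡3Σ) m row-m =
  trans (cong ι (h₁≡Σ m)) (trans row-sum (sym (proj₁ (sec-boundary (2 ℕ.* m))))) ,
  trans (cong ι (h₂≡3Σ m)) (trans (ι-* (+ 3) (rowSum h (suc m)))
    (trans (cong (three *_) row-sum) (sym (proj₂ (sec-boundary (2 ℕ.* m))))))
  where
  row-sum : ι (rowSum h (suc m)) ≡ antidiagonal Qsec (2 ℕ.* m)
  row-sum = rowSum-agrees h Qsec m row-m

Z-agrees : ∀ f P → Even₂ P → P 0 0 ≡ 1ℚ → (∀ n → AgreesOnRow f (scaled P) n) → ∀ a b → Z f a b ≡ P a b
Z-agrees f P P-even P₀₀≡1 rows a b with half (a ℕ.+ b) in eq
... | nothing = sym (P-even a b eq)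
... | just zero rewrite ℕP.m+n≡0⇒m≡0 a (half-just (a ℕ.+ b) eq) | ℕP.m+n≡0⇒n≡0 a (half-just (a ℕ.+ b) eq) = sym P₀₀≡1
... | just (suc n) = sym (*≡ι⇒≡/ (P a b) (f (suc (suc n)) (suc b)) (a ! ℕ.* b !) {{a !* b !≢0}}
                       (sym (rows (suc n) a b (half-just (a ℕ.+ b) eq))))

theorem1p2 : (g h : ℕ → ℕ → ℤ) → IsG g → IsH h →
    (∀ a b → Z g a b ≡ (atSum secS ⊛ atDiff cosS) a b)
    × (∀ a b → Z h a b ≡ ((atSum secS ⊛ atSum secS) ⊛ atDiff cosS) a b)
theorem1p2 g h isG@(g-rec , g₁₁≡1 , _) isH@(h-rec , h₁₁≡1 , _) =
  Z-agrees g Ptan Ptan-even refl (family-determined g Qtan g-rec Qtan-step (cong ι g₁₁≡1) (g-boundary g isG)) ,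
  Z-agrees h Psec Psec-even refl (family-determined h Qsec h-rec Qsec-step (cong ι h₁₁≡1) (h-boundary h isH))
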